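{- Let $X$ be a finite set of constant symbols and let $F$ be a ground, negation-free formula (built from atoms using only $\land$ and $\lor$) in the language of linear real arithmetic over $X$, i.e. every atom has the form $s \le t$ or $s = t$ with $s,t$ linear terms with rational coefficients in the symbols of $X$. Then $F$ is satisfiable modulo $\mathbf{LRA}$ if and only if $F$ is satisfiable modulo $\mathbf{LRR}$.
   Context: $\mathbf{LRA}$ is the theory of linear real arithmetic; $F$ is satisfiable modulo $\mathbf{LRA}$ iff some assignment of real numbers to the symbols of $X$ makes $F$ true in $\mathbb{R}$. The signature of ordered rings $\sigma_{or}$ consists of binary function symbols $+,\cdot$, constants $0,1$, equality and a binary relation $\le$; $\sigma_{or}(X)$ adds the symbols of $X$ as constants. Atoms with rational coefficients are regarded as abbreviations of $\sigma_{or}(X)$-atoms obtained by clearing denominators and moving terms (e.g. $0 \le \tfrac12 x - y$ abbreviates $(1+1)\cdot y \le x$). $\mathbf{LRR}$ (linear real rings) is the $\sigma_{or}$-theory axiomatized by: the commutative ring axioms (associativity and commutativity of $+$ and $\cdot$, $x+0=x$, $x\cdot 1 = x$, distributivity, existence of additive inverses); reflexivity, transitivity and antisymmetry of $\le$; $\forall x,y,z\,(x\le y \Rightarrow x+z \le y+z)$; $0 \le 1 \land 0 \ne 1$; for each integer $n\ge 1$, $\exists x\,(x+\dots+x = 1)$ ($n$ summands); and for each integer $n \ge 1$, $\forall x\,(0 \le x+\dots+x \Rightarrow 0 \le x)$ ($n$ summands). $F$ is satisfiable modulo $\mathbf{LRR}$ iff some $\sigma_{or}(X)$-structure that is a model of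 $\mathbf{LRR}$ satisfies $F$. -}

module Defs where

open import Data.Nat as ℕ using (ℕ; zero; suc; _≥_)
open import Data.Nat.DivMod using (_/_)
open import Data.Integer as ℤ using (ℤ; +_; -[1+_])
open import Data.Rational as ℚ using (ℚ; ↥_; ↧ₙ_)
open import Data.Fin using (Fin)
import Data.Fin as Fin
open import Data.Product using (Σ; ∃; _×_; _,_)
open import Data.Sum using (_⊎_)
open import Relation.Binary.PropositionalEquality using (_≡_; _≢_)
open import Function using (_∘_)

record Structure : Set₁ where
  infixl 6 _⊕_
  infixl 7 _⊗_
  infix 4 _≼_
  field
    Carrier : Set
    _⊕_ _⊗_ : Carrier → Carrier → Carrier
    𝟘 𝟙 : Carrier
    _≼_ : Carrier → Carrier → Set

module _ (S : Structure) where
  open Structure S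

  times : ℕ → Carrier → Carrier
  times zero x = 𝟘
  times (suc zero) x = x
  times (suc (suc n)) x = x ⊕ times (suc n) x

  numeral : ℕ → Carrier
  numeral zero = 𝟘
  numeral (suc n) = 𝟙 ⊕ numeral n

  sumFin : (n : ℕ) → (Fin n → Carrier) → Carrier
  sumFin zero f = 𝟘
  sumFin (suc n) f = f Fin.zero ⊕ sumFin n (f ∘ Fin.suc)

record IsLRR (S : Structure) : Set where
  open Structure S
  field
    +-assoc : ∀ x y z → (x ⊕ y) ⊕ z ≡ x ⊕ (y ⊕ z)
    +-comm : ∀ x y → x ⊕ y ≡ y ⊕ x
    *-assoc : ∀ x y z → (x ⊗ y) ⊗ z ≡ x ⊗ (y ⊗ z)
    *-comm : ∀ x y → x ⊗ y ≡ y ⊗ x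
    +-identity : ∀ x → x ⊕ 𝟘 ≡ x
    *-identity : ∀ x → x ⊗ 𝟙 ≡ x
    distrib : ∀ x y z → x ⊗ (y ⊕ z) ≡ (x ⊗ y) ⊕ (x ⊗ z)
    +-inverse : ∀ x → ∃ λ y → x ⊕ y ≡ 𝟘
    ≼-refl : ∀ x → x ≼ x
    ≼-trans : ∀ x y z → x ≼ y → y ≼ z → x ≼ z
    ≼-antisym : ∀ x y → x ≼ y → y ≼ x → x ≡ y
    +-mono : ∀ x y z → x ≼ y → x ⊕ z ≼ y ⊕ z
    0≼1 : 𝟘 ≼ 𝟙
    0≢1 : 𝟘 ≢ 𝟙
    divisible : ∀ n → n ≥ 1 → ∃ λ x → times S n x ≡ 𝟙
    torsion-free : ∀ n → n ≥ 1 → ∀ x → 𝟘 ≼ times S n x → 𝟘 ≼ x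

-- Axioms characterising the real numbers (up to isomorphism):
-- a Dedekind-complete ordered field.

record IsReals (S : Structure) : Set₁ where
  open Structure S
  field
    +-assoc : ∀ x y z → (x ⊕ y) ⊕ z ≡ x ⊕ (y ⊕ z)
    +-comm : ∀ x y → x ⊕ y ≡ y ⊕ x
    *-assoc : ∀ x y z → (x ⊗ y) ⊗ z ≡ x ⊗ (y ⊗ z)
    *-comm : ∀ x y → x ⊗ y ≡ y ⊗ x
    +-identity : ∀ x → x ⊕ 𝟘 ≡ x
    *-identity : ∀ x → x ⊗ 𝟙 ≡ x
    distrib : ∀ x y z → x ⊗ (y ⊕ z) ≡ (x ⊗ y) ⊕ (x ⊗ z)
    +-inverse : ∀ x → ∃ λ y → x ⊕ y ≡ 𝟘
    *-inverse : ∀ x → x ≢ 𝟘 → ∃ λ y → x ⊗ y ≡ 𝟙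
    0≢1 : 𝟘 ≢ 𝟙
    ≼-refl : ∀ x → x ≼ x
    ≼-trans : ∀ x y z → x ≼ y → y ≼ z → x ≼ z
    ≼-antisym : ∀ x y → x ≼ y → y ≼ x → x ≡ y
    ≼-total : ∀ x y → x ≼ y ⊎ y ≼ x
    +-mono : ∀ x y z → x ≼ y → x ⊕ z ≼ y ⊕ z
    *-mono : ∀ x y → 𝟘 ≼ x → 𝟘 ≼ y → 𝟘 ≼ x ⊗ y
    complete : (P : Carrier → Set) → ∃ P → (∃ λ b → ∀ x → P x → x ≼ b) →
               ∃ λ s → (∀ x → P x → x ≼ s) × (∀ b → (∀ x → P x → x ≼ b) → s ≼ b)

record LinTerm (n : ℕ) : Set where
  constructor linTerm
  field
    coeff : Fin n → ℚ
    const : ℚ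

data Formula (n : ℕ) : Set where
  _≤ₐ_ : LinTerm n → LinTerm n → Formula n
  _=ₐ_ : LinTerm n → LinTerm n → Formula n
  _∧_ : Formula n → Formula n → Formula n
  _∨_ : Formula n → Formula n → Formula n

-- An atom  s ⋈ t  is read as  0 ⋈ (t - s) = Σ eᵢ xᵢ + e₀ ; multiplying by
-- the positive integer D = ∏ denominators gives integer coefficients kᵢ,
-- and the σ_or(X)-atom is  Σ_{kᵢ<0} |kᵢ|·xᵢ + [|k₀|] ⋈ Σ_{kᵢ>0} kᵢ·xᵢ + [k₀].

posPart : ℤ → ℕ
posPart (+ m) = m
posPart -[1+ m ] = 0

negPart : ℤ → ℕ
negPart (+ m) = 0
negPart -[1+ m ] = suc m

prodFin : (n : ℕ) → (Fin n → ℕ) → ℕ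
prodFin zero f = 1
prodFin (suc n) f = f Fin.zero ℕ.* prodFin n (f ∘ Fin.suc)

commonDen : {n : ℕ} → (Fin n → ℚ) → ℚ → ℕ
commonDen {n} e e₀ = prodFin n (λ i → ↧ₙ e i) ℕ.* ↧ₙ e₀

-- q · D as an integer, for D a multiple of the denominator of q
scaleBy : ℕ → ℚ → ℤ
scaleBy D q = (↥ q) ℤ.* (+ (D / ↧ₙ q))

module _ (S : Structure) where
  open Structure S

  clearedSides : {n : ℕ} → (Fin n → Carrier) → LinTerm n → LinTerm n →
                 Carrier × Carrier
  clearedSides {n} ρ s t =
      (sumFin S n (λ i → numeral S (negPart (k i)) ⊗ ρ i) ⊕ numeral S (negPart k₀))
    , (sumFin S n (λ i → numeral S (posPart (k i)) ⊗ ρ i) ⊕ numeral S (posPart k₀))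
    where
      e : Fin n → ℚ
      e i = LinTerm.coeff t i ℚ.- LinTerm.coeff s i
      e₀ : ℚ
      e₀ = LinTerm.const t ℚ.- LinTerm.const s
      D : ℕ
      D = commonDen e e₀
      k : Fin n → ℤ
      k i = scaleBy D (e i)
      k₀ : ℤ
      k₀ = scaleBy D e₀

  _⊨_ : {n : ℕ} → (Fin n → Carrier) → Formula n → Set
  ρ ⊨ (s ≤ₐ t) = let (l , r) = clearedSides ρ s t in l ≼ r
  ρ ⊨ (s =ₐ t) = let (l , r) = clearedSides ρ s t in l ≡ r
  ρ ⊨ (F ∧ G) = (ρ ⊨ F) × (ρ ⊨ G)
  ρ ⊨ (F ∨ G) = (ρ ⊨ F) ⊎ (ρ ⊨ G)

SatIn : (S : Structure) → {n : ℕ} → Formula n → Set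
SatIn S {n} F = Σ (Fin n → Structure.Carrier S) λ ρ → _⊨_ S ρ F

SatLRA : (ℝ : Structure) → IsReals ℝ → {n : ℕ} → Formula n → Set
SatLRA ℝ _ F = SatIn ℝ F

SatLRR : {n : ℕ} → Formula n → Set₁
SatLRR F = Σ Structure λ S → IsLRR S × SatIn S F

{-# OPTIONS --safe #-}
-- After clearing denominators, F is a disjunction of systems of linear
-- inequalities with natural coefficients, and we run Fourier–Motzkin
-- elimination on a satisfied system.  Pairing each lower bound on a variable
-- with each upper bound produces consequences of the system in every
-- commutative ring with a translation-invariant partial order, in
-- particular in every model of LRR.  Over the reals the converse holds: a
-- solution of the eliminated system extends to the original one, since the
-- eliminated variable can be chosen between its largest lower and its least
-- upper bound.  Eliminating all variables leaves inequalities between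
-- numerals, which hold in a model of LRR exactly when they hold in ℕ.  The
-- other direction is immediate, as the reals are a model of LRR.
module Submission where

open import Defs
open import Level using (0ℓ)
open import Data.Nat as ℕ using (ℕ; zero; suc; _≤_; z≤n; s≤s)
import Data.Nat.Properties as ℕ
open import Data.Integer using (ℤ)
import Data.Rational as ℚ
open import Data.Fin using (Fin)
open import Data.Vec.Functional using (Vector; head; tail) renaming ([] to []ᵛ; _∷_ to _∷ᵛ_)
open import Data.Product using (∃; _×_; _,_; proj₁; proj₂)
open import Data.Sum using (_⊎_; inj₁; inj₂)
open import Data.Unit using (⊤; tt)
open import Data.Empty using (⊥-elim)
open import Data.List using (List; []; _∷_; _++_; cartesianProductWith)
open import Data.List.Membership.Propositional using (_∈_)
open import Data.List.Membership.Propositional.Properties using (∈-cartesianProductWith⁺)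
open import Data.List.Relation.Unary.Any using (here; there)
open import Data.List.Relation.Unary.All as All using (All; []; _∷_)
open import Data.List.Relation.Unary.All.Properties using (++⁺; ++⁻; cartesianProductWith⁺)
open import Function using (_∘_; _⇔_; mk⇔; Equivalence)
import Function.Properties.Equivalence as ⇔
open import Algebra.Bundles using (CommutativeRing)
open import Algebra.Structures using (IsCommutativeRing)
open import Algebra.Consequences.Propositional
  using (comm∧idʳ⇒id; comm∧invʳ⇒inv; comm∧distrˡ⇒distr)
open import Relation.Binary.Bundles using (Poset)
open import Relation.Binary.PropositionalEquality
import Relation.Binary.Reasoning.PartialOrder
import Algebra.Properties.CommutativeSemigroup
open Equivalence using (to; from)

record Lin (n : ℕ) : Set where
  constructor lin
  field
    coeffs : Fin n → ℕ
    const : ℕ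

infix 4 _≤ₗ_
record Ineq (n : ℕ) : Set where
  constructor _≤ₗ_
  field
    lhs rhs : Lin n

infixl 6 _+ₗ_
_+ₗ_ : ∀ {n} → Lin n → Lin n → Lin n
lin a c +ₗ lin b d = lin (λ i → a i ℕ.+ b i) (c ℕ.+ d)

infixr 7 _·ₗ_
_·ₗ_ : ∀ {n} → ℕ → Lin n → Lin n
k ·ₗ lin a c = lin (λ i → k ℕ.* a i) (k ℕ.* c)

-- Fourier–Motzkin elimination of the first variable x₀

-- bound k A B is read as  A ≤ (1 + k) x₀ + B  when used as a lower bound
-- and as  (1 + k) x₀ + A ≤ B  when used as an upper bound.
record Bound (m : ℕ) : Set where
  constructor bound
  field
    pred-coeff : ℕ
    lhs rhs : Lin m

data Classified (m : ℕ) : Set where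
  free : Ineq m → Classified m
  lower upper : Bound m → Classified m

classifyBy : ∀ {m} a b → ℕ.Ordering a b → Lin m → Lin m → Classified m
classifyBy a _ (ℕ.less _ k) A B = lower (bound k A B)
classifyBy a _ (ℕ.equal _) A B = free (A ≤ₗ B)
classifyBy _ b (ℕ.greater _ k) A B = upper (bound k A B)

classify : ∀ {m} → Ineq (suc m) → Classified m
classify (lin a c ≤ₗ lin b d) =
  classifyBy (head a) (head b) (ℕ.compare (head a) (head b)) (lin (tail a) c) (lin (tail b) d)

record Split (m : ℕ) : Set where
  constructor split
  field
    frees : List (Ineq m)
    lowers uppers : List (Bound m)

open Split

infixr 5 _∷ₛ_
_∷ₛ_ : ∀ {m} → Classified m → Split m → Split m
free c ∷ₛ split fs ls us = split (c ∷ fs) ls us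
lower l ∷ₛ split fs ls us = split fs (l ∷ ls) us
upper u ∷ₛ split fs ls us = split fs ls (u ∷ us)

splitOnHead : ∀ {m} → List (Ineq (suc m)) → Split m
splitOnHead [] = split [] [] []
splitOnHead (c ∷ cs) = classify c ∷ₛ splitOnHead cs

-- Scales both bounds to the common coefficient (1 + j)(1 + k) of x₀ and
-- chains them, so that x₀ cancels.
combine : ∀ {m} → Bound m → Bound m → Ineq m
combine (bound k A₁ B₁) (bound j A₂ B₂) =
  suc j ·ₗ A₁ +ₗ suc k ·ₗ A₂ ≤ₗ suc j ·ₗ B₁ +ₗ suc k ·ₗ B₂

eliminate : ∀ {m} → List (Ineq (suc m)) → List (Ineq m)
eliminate cs = frees s ++ cartesianProductWith combine (lowers s) (uppers s)
  where s = splitOnHead cs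

module _ {n : ℕ} (s t : LinTerm n) where
  private
    e : Fin n → ℚ.ℚ
    e i = LinTerm.coeff t i ℚ.- LinTerm.coeff s i
    e₀ : ℚ.ℚ
    e₀ = LinTerm.const t ℚ.- LinTerm.const s

  clearedCoeff : Fin n → ℤ
  clearedCoeff i = scaleBy (commonDen e e₀) (e i)

  clearedConst : ℤ
  clearedConst = scaleBy (commonDen e e₀) e₀

  clearedLhs clearedRhs : Lin n
  clearedLhs = lin (negPart ∘ clearedCoeff) (negPart clearedConst)
  clearedRhs = lin (posPart ∘ clearedCoeff) (posPart clearedConst)

-- A choice of one side of every ∨; the systems  ineqs F d  are the
-- conjunctions of the disjunctive normal form of F.
Disjunct : ∀ {n} → Formula n → Set
Disjunct (s ≤ₐ t) = ⊤
Disjunct (s =ₐ t) = ⊤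
Disjunct (F ∧ G) = Disjunct F × Disjunct G
Disjunct (F ∨ G) = Disjunct F ⊎ Disjunct G

ineqs : ∀ {n} (F : Formula n) → Disjunct F → List (Ineq n)
ineqs (s ≤ₐ t) _ = (clearedLhs s t ≤ₗ clearedRhs s t) ∷ []
ineqs (s =ₐ t) _ = (clearedLhs s t ≤ₗ clearedRhs s t) ∷ (clearedRhs s t ≤ₗ clearedLhs s t) ∷ []
ineqs (F ∧ G) (d , e) = ineqs F d ++ ineqs G e
ineqs (F ∨ G) (inj₁ d) = ineqs F d
ineqs (F ∨ G) (inj₂ e) = ineqs G e

-- The axioms shared by IsLRR and IsReals; no compatibility of the order
-- with multiplication is assumed.
record IsAdditivelyOrderedRing (S : Structure) : Set where
  open Structure S
  field
    +-assoc : ∀ x y z → (x ⊕ y) ⊕ z ≡ x ⊕ (y ⊕ z)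
    +-comm : ∀ x y → x ⊕ y ≡ y ⊕ x
    *-assoc : ∀ x y z → (x ⊗ y) ⊗ z ≡ x ⊗ (y ⊗ z)
    *-comm : ∀ x y → x ⊗ y ≡ y ⊗ x
    +-identity : ∀ x → x ⊕ 𝟘 ≡ x
    *-identity : ∀ x → x ⊗ 𝟙 ≡ x
    distrib : ∀ x y z → x ⊗ (y ⊕ z) ≡ (x ⊗ y) ⊕ (x ⊗ z)
    +-inverse : ∀ x → ∃ λ y → x ⊕ y ≡ 𝟘
    ≼-refl : ∀ x → x ≼ x
    ≼-trans : ∀ x y z → x ≼ y → y ≼ z → x ≼ z
    ≼-antisym : ∀ x y → x ≼ y → y ≼ x → x ≡ y
    +-mono : ∀ x y z → x ≼ y → x ⊕ z ≼ y ⊕ z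

module AdditivelyOrderedRing {S : Structure} (O : IsAdditivelyOrderedRing S) where
  open Structure S
  open IsAdditivelyOrderedRing O

  neg : Carrier → Carrier
  neg x = proj₁ (+-inverse x)

  isCommutativeRing : IsCommutativeRing _≡_ _⊕_ _⊗_ neg 𝟘 𝟙
  isCommutativeRing = record
    { isRing = record
      { +-isAbelianGroup = record
        { isGroup = record
          { isMonoid = record
            { isSemigroup = record
              { isMagma = record { isEquivalence = isEquivalence ; ∙-cong = cong₂ _⊕_ }
              ; assoc = +-assoc }
            ; identity = comm∧idʳ⇒id +-comm +-identity }
          ; inverse = comm∧invʳ⇒inv +-comm (λ x → proj₂ (+-inverse x))
          ; ⁻¹-cong = cong neg }
        ; comm = +-comm }
      ; *-cong = cong₂ _⊗_
      ; *-assoc = *-assoc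
      ; *-identity = comm∧idʳ⇒id *-comm *-identity
      ; distrib = comm∧distrˡ⇒distr (cong₂ _⊕_) *-comm distrib }
    ; *-comm = *-comm }

  commutativeRing : CommutativeRing 0ℓ 0ℓ
  commutativeRing = record { isCommutativeRing = isCommutativeRing }

  open CommutativeRing commutativeRing
    using (+-abelianGroup; +-commutativeMonoid; +-commutativeSemigroup; semiring; +-identityˡ; *-identityˡ)
  open import Algebra.Properties.CommutativeMonoid.Mult +-commutativeMonoid
    renaming (_×_ to _·_) public
  open import Algebra.Properties.CommutativeMonoid.Sum +-commutativeMonoid
    using (sum; sum-cong-≗; ∑-distrib-+) public
  open import Algebra.Properties.CommutativeSemigroup +-commutativeSemigroup
    using (interchange; xy∙z≈y∙xz; x∙yz≈y∙xz) public
  open import Algebra.Properties.AbelianGroup +-abelianGroup using (xyx⁻¹≈y)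
  open import Algebra.Properties.Semiring.Mult semiring using (×-assoc-*)

  ≼-poset : Poset 0ℓ 0ℓ 0ℓ
  ≼-poset = record
    { isPartialOrder = record
      { isPreorder = record
        { isEquivalence = isEquivalence
        ; reflexive = λ { refl → ≼-refl _ }
        ; trans = ≼-trans _ _ _ }
      ; antisym = ≼-antisym _ _ } }

  module ≼-Reasoning = Relation.Binary.Reasoning.PartialOrder ≼-poset

  +-monoˡ-≼ : ∀ z {x y} → x ≼ y → z ⊕ x ≼ z ⊕ y
  +-monoˡ-≼ z {x} {y} x≼y = subst₂ _≼_ (+-comm x z) (+-comm y z) (+-mono x y z x≼y)

  +-mono-≼ : ∀ {x y u v} → x ≼ y → u ≼ v → x ⊕ u ≼ y ⊕ v
  +-mono-≼ {x} {y} {u} x≼y u≼v = ≼-trans _ _ _ (+-mono x y u x≼y) (+-monoˡ-≼ y u≼v)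

  +-cancelˡ-≼ : ∀ z {x y} → z ⊕ x ≼ z ⊕ y → x ≼ y
  +-cancelˡ-≼ z {x} {y} h = subst₂ _≼_ (xyx⁻¹≈y z x) (xyx⁻¹≈y z y) (+-mono _ _ (neg z) h)

  +-cancelʳ-≼ : ∀ z {x y} → x ⊕ z ≼ y ⊕ z → x ≼ y
  +-cancelʳ-≼ z {x} {y} h = +-cancelˡ-≼ z (subst₂ _≼_ (+-comm x z) (+-comm y z) h)

  ·-mono-≼ : ∀ n {x y} → x ≼ y → n · x ≼ n · y
  ·-mono-≼ zero x≼y = ≼-refl 𝟘
  ·-mono-≼ (suc n) x≼y = +-mono-≼ x≼y (·-mono-≼ n x≼y)

  ·-zeroʳ : ∀ n → n · 𝟘 ≡ 𝟘
  ·-zeroʳ zero = refl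
  ·-zeroʳ (suc n) = trans (+-identityˡ (n · 𝟘)) (·-zeroʳ n)

  ·-comm : ∀ m n x → m · (n · x) ≡ n · (m · x)
  ·-comm m n x = trans (×-assocˡ x m n) (trans (cong (_· x) (ℕ.*-comm m n)) (sym (×-assocˡ x n m)))

  ·-suc-+ : ∀ a k x → suc (a ℕ.+ k) · x ≡ a · x ⊕ suc k · x
  ·-suc-+ a k x = trans (cong (_· x) (sym (ℕ.+-suc a k))) (×-homo-+ x a (suc k))

  ·≡·𝟙⊗ : ∀ n x → n · x ≡ (n · 𝟙) ⊗ x
  ·≡·𝟙⊗ n x = sym (trans (×-assoc-* n 𝟙 x) (cong (n ·_) (*-identityˡ x)))

  ·-distrib-sum : ∀ {n} k (f : Vector Carrier n) → k · sum f ≡ sum (λ i → k · f i)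
  ·-distrib-sum {zero} k f = ·-zeroʳ k
  ·-distrib-sum {suc n} k f =
    trans (×-distrib-+ (head f) (sum (tail f)) k) (cong (k · head f ⊕_) (·-distrib-sum k (tail f)))

  ⟦_⟧ : ∀ {n} → Lin n → Vector Carrier n → Carrier
  ⟦ lin a c ⟧ ρ = sum (λ i → a i · ρ i) ⊕ c · 𝟙

  infix 4 _⊨ₗ_
  _⊨ₗ_ : ∀ {n} → Vector Carrier n → Ineq n → Set
  ρ ⊨ₗ (A ≤ₗ B) = ⟦ A ⟧ ρ ≼ ⟦ B ⟧ ρ

  ⟦+ₗ⟧ : ∀ {n} A B (ρ : Vector Carrier n) → ⟦ A +ₗ B ⟧ ρ ≡ ⟦ A ⟧ ρ ⊕ ⟦ B ⟧ ρ
  ⟦+ₗ⟧ {n} (lin a c) (lin b d) ρ = begin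
    sum (λ i → (a i ℕ.+ b i) · ρ i) ⊕ (c ℕ.+ d) · 𝟙
      ≡⟨ cong₂ _⊕_ (trans (sum-cong-≗ λ i → ×-homo-+ (ρ i) (a i) (b i)) (∑-distrib-+ {n} _ _))
                   (×-homo-+ 𝟙 c d) ⟩
    (sum (λ i → a i · ρ i) ⊕ sum (λ i → b i · ρ i)) ⊕ (c · 𝟙 ⊕ d · 𝟙)
      ≡⟨ interchange _ _ _ _ ⟩
    ⟦ lin a c ⟧ ρ ⊕ ⟦ lin b d ⟧ ρ ∎
    where open ≡-Reasoning

  ⟦·ₗ⟧ : ∀ {n} k A (ρ : Vector Carrier n) → ⟦ k ·ₗ A ⟧ ρ ≡ k · ⟦ A ⟧ ρ
  ⟦·ₗ⟧ {n} k (lin a c) ρ = begin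
    sum (λ i → (k ℕ.* a i) · ρ i) ⊕ (k ℕ.* c) · 𝟙
      ≡⟨ cong₂ _⊕_ (sum-cong-≗ λ i → ×-assocˡ (ρ i) k (a i)) (×-assocˡ 𝟙 k c) ⟨
    sum (λ i → k · (a i · ρ i)) ⊕ k · (c · 𝟙)
      ≡⟨ cong (_⊕ k · (c · 𝟙)) (·-distrib-sum {n} k _) ⟨
    k · sum (λ i → a i · ρ i) ⊕ k · (c · 𝟙)
      ≡⟨ ×-distrib-+ _ _ k ⟨
    k · ⟦ lin a c ⟧ ρ ∎
    where open ≡-Reasoning

  ⟦·ₗ+ₗ·ₗ⟧ : ∀ {n} p q A B (ρ : Vector Carrier n) → ⟦ p ·ₗ A +ₗ q ·ₗ B ⟧ ρ ≡ p · ⟦ A ⟧ ρ ⊕ q · ⟦ B ⟧ ρ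
  ⟦·ₗ+ₗ·ₗ⟧ p q A B ρ = trans (⟦+ₗ⟧ (p ·ₗ A) (q ·ₗ B) ρ) (cong₂ _⊕_ (⟦·ₗ⟧ p A ρ) (⟦·ₗ⟧ q B ρ))

  ⟦⟧-head : ∀ {m} a c (ρ : Vector Carrier (suc m)) →
    ⟦ lin a c ⟧ ρ ≡ head a · head ρ ⊕ ⟦ lin (tail a) c ⟧ (tail ρ)
  ⟦⟧-head a c ρ = +-assoc _ _ _

  module _ {m : ℕ} (ρ : Vector Carrier m) (x : Carrier) where

    LowerBoundHolds UpperBoundHolds : Bound m → Set
    LowerBoundHolds (bound k A B) = ⟦ A ⟧ ρ ≼ suc k · x ⊕ ⟦ B ⟧ ρ
    UpperBoundHolds (bound k A B) = suc k · x ⊕ ⟦ A ⟧ ρ ≼ ⟦ B ⟧ ρ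

    ClassifiedHolds : Classified m → Set
    ClassifiedHolds (free c) = ρ ⊨ₗ c
    ClassifiedHolds (lower l) = LowerBoundHolds l
    ClassifiedHolds (upper u) = UpperBoundHolds u

    SplitHolds : Split m → Set
    SplitHolds (split fs ls us) =
      All (ρ ⊨ₗ_) fs × All LowerBoundHolds ls × All UpperBoundHolds us

    classifyBy-correct : ∀ a b o A B →
      (a · x ⊕ ⟦ A ⟧ ρ ≼ b · x ⊕ ⟦ B ⟧ ρ) ⇔ ClassifiedHolds (classifyBy a b o A B)
    classifyBy-correct a _ (ℕ.less _ k) A B = mk⇔
      (λ h → +-cancelˡ-≼ (a · x) (subst (a · x ⊕ ⟦ A ⟧ ρ ≼_) split-x h))
      (λ h → subst (a · x ⊕ ⟦ A ⟧ ρ ≼_) (sym split-x) (+-monoˡ-≼ (a · x) h))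
      where
      split-x : suc (a ℕ.+ k) · x ⊕ ⟦ B ⟧ ρ ≡ a · x ⊕ (suc k · x ⊕ ⟦ B ⟧ ρ)
      split-x = trans (cong (_⊕ ⟦ B ⟧ ρ) (·-suc-+ a k x)) (+-assoc _ _ _)
    classifyBy-correct a _ (ℕ.equal _) A B = mk⇔ (+-cancelˡ-≼ (a · x)) (+-monoˡ-≼ (a · x))
    classifyBy-correct _ b (ℕ.greater _ k) A B = mk⇔
      (λ h → +-cancelˡ-≼ (b · x) (subst (_≼ b · x ⊕ ⟦ B ⟧ ρ) split-x h))
      (λ h → subst (_≼ b · x ⊕ ⟦ B ⟧ ρ) (sym split-x) (+-monoˡ-≼ (b · x) h))
      where
      split-x : suc (b ℕ.+ k) · x ⊕ ⟦ A ⟧ ρ ≡ b · x ⊕ (suc k · x ⊕ ⟦ A ⟧ ρ)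
      split-x = trans (cong (_⊕ ⟦ A ⟧ ρ) (·-suc-+ b k x)) (+-assoc _ _ _)

    ∷ₛ⁺ : ∀ c s → ClassifiedHolds c → SplitHolds s → SplitHolds (c ∷ₛ s)
    ∷ₛ⁺ (free _) (split _ _ _) h (hf , hl , hu) = h ∷ hf , hl , hu
    ∷ₛ⁺ (lower _) (split _ _ _) h (hf , hl , hu) = hf , h ∷ hl , hu
    ∷ₛ⁺ (upper _) (split _ _ _) h (hf , hl , hu) = hf , hl , h ∷ hu

    ∷ₛ⁻ : ∀ c s → SplitHolds (c ∷ₛ s) → ClassifiedHolds c × SplitHolds s
    ∷ₛ⁻ (free _) (split _ _ _) (h ∷ hf , hl , hu) = h , hf , hl , hu
    ∷ₛ⁻ (lower _) (split _ _ _) (hf , h ∷ hl , hu) = h , hf , hl , hu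
    ∷ₛ⁻ (upper _) (split _ _ _) (hf , hl , h ∷ hu) = h , hf , hl , hu

  classify-correct : ∀ {m} (ρ : Vector Carrier (suc m)) c →
    (ρ ⊨ₗ c) ⇔ ClassifiedHolds (tail ρ) (head ρ) (classify c)
  classify-correct ρ (lin a c ≤ₗ lin b d) =
    ⇔.trans (mk⇔ (subst₂ _≼_ (⟦⟧-head a c ρ) (⟦⟧-head b d ρ))
                 (subst₂ _≼_ (sym (⟦⟧-head a c ρ)) (sym (⟦⟧-head b d ρ))))
            (classifyBy-correct (tail ρ) (head ρ) (head a) (head b) (ℕ.compare (head a) (head b))
               (lin (tail a) c) (lin (tail b) d))

  splitOnHead-correct : ∀ {m} (ρ : Vector Carrier (suc m)) cs →
    All (ρ ⊨ₗ_) cs ⇔ SplitHolds (tail ρ) (head ρ) (splitOnHead cs)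
  splitOnHead-correct ρ [] = mk⇔ (λ _ → [] , [] , []) (λ _ → [])
  splitOnHead-correct ρ (c ∷ cs) = mk⇔
    (λ { (h ∷ hs) → ∷ₛ⁺ (tail ρ) (head ρ) (classify c) _
                      (to (classify-correct ρ c) h) (to (splitOnHead-correct ρ cs) hs) })
    (λ h → let (hc , hs) = ∷ₛ⁻ (tail ρ) (head ρ) (classify c) _ h
           in from (classify-correct ρ c) hc ∷ from (splitOnHead-correct ρ cs) hs)

  combine-sound : ∀ {m} (ρ : Vector Carrier m) x l u →
    LowerBoundHolds ρ x l → UpperBoundHolds ρ x u → ρ ⊨ₗ combine l u
  combine-sound ρ x (bound k A₁ B₁) (bound j A₂ B₂) lo up = begin
    ⟦ q ·ₗ A₁ +ₗ p ·ₗ A₂ ⟧ ρ        ≡⟨ ⟦·ₗ+ₗ·ₗ⟧ q p A₁ A₂ ρ ⟩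
    q · a₁ ⊕ p · a₂                 ≤⟨ +-mono _ _ _ (·-mono-≼ q lo) ⟩
    q · (p · x ⊕ b₁) ⊕ p · a₂       ≡⟨ cong (_⊕ p · a₂) (×-distrib-+ (p · x) b₁ q) ⟩
    q · (p · x) ⊕ q · b₁ ⊕ p · a₂   ≡⟨ xy∙z≈y∙xz _ _ _ ⟩
    q · b₁ ⊕ (q · (p · x) ⊕ p · a₂) ≡⟨ cong (λ t → q · b₁ ⊕ (t ⊕ p · a₂)) (·-comm q p x) ⟩
    q · b₁ ⊕ (p · (q · x) ⊕ p · a₂) ≡⟨ cong (q · b₁ ⊕_) (×-distrib-+ (q · x) a₂ p) ⟨
    q · b₁ ⊕ p · (q · x ⊕ a₂)       ≤⟨ +-monoˡ-≼ (q · b₁) (·-mono-≼ p up) ⟩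
    q · b₁ ⊕ p · b₂                 ≡⟨ ⟦·ₗ+ₗ·ₗ⟧ q p B₁ B₂ ρ ⟨
    ⟦ q ·ₗ B₁ +ₗ p ·ₗ B₂ ⟧ ρ        ∎
    where
    open ≼-Reasoning
    p q : ℕ
    p = suc k
    q = suc j
    a₁ a₂ b₁ b₂ : Carrier
    a₁ = ⟦ A₁ ⟧ ρ
    a₂ = ⟦ A₂ ⟧ ρ
    b₁ = ⟦ B₁ ⟧ ρ
    b₂ = ⟦ B₂ ⟧ ρ

  eliminate-sound : ∀ {m} (ρ : Vector Carrier (suc m)) cs →
    All (ρ ⊨ₗ_) cs → All (tail ρ ⊨ₗ_) (eliminate cs)
  eliminate-sound ρ cs h =
    let (hf , hl , hu) = to (splitOnHead-correct ρ cs) h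
    in ++⁺ hf (cartesianProductWith⁺ (setoid _) (setoid _) combine _ _
                 λ {l} {u} l∈ u∈ → combine-sound (tail ρ) (head ρ) l u (All.lookup hl l∈) (All.lookup hu u∈))

  module _ (0≼1 : 𝟘 ≼ 𝟙) where

    ·𝟙-mono-≤ : ∀ {m n} → m ≤ n → m · 𝟙 ≼ n · 𝟙
    ·𝟙-mono-≤ {n = zero} z≤n = ≼-refl 𝟘
    ·𝟙-mono-≤ {n = suc n} z≤n =
      subst (_≼ suc n · 𝟙) (+-identity 𝟘) (+-mono-≼ 0≼1 (·𝟙-mono-≤ {n = n} z≤n))
    ·𝟙-mono-≤ (s≤s m≤n) = +-monoˡ-≼ 𝟙 (·𝟙-mono-≤ m≤n)

    ·𝟙-cancel-≤ : 𝟘 ≢ 𝟙 → ∀ {m n} → m · 𝟙 ≼ n · 𝟙 → m ≤ n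
    ·𝟙-cancel-≤ 0≢1 {zero} h = z≤n
    ·𝟙-cancel-≤ 0≢1 {suc m} {zero} h = ⊥-elim (0≢1 (≼-antisym _ _ 0≼1 1≼0))
      where
      1≼0 : 𝟙 ≼ 𝟘
      1≼0 = ≼-trans _ _ _ (subst (_≼ suc m · 𝟙) (+-identity 𝟙) (+-monoˡ-≼ 𝟙 (·𝟙-mono-≤ {n = m} z≤n))) h
    ·𝟙-cancel-≤ 0≢1 {suc m} {suc n} h = s≤s (·𝟙-cancel-≤ 0≢1 (+-cancelˡ-≼ 𝟙 h))

    ⊨ₗ-closed⇔ : 𝟘 ≢ 𝟙 → ∀ (ρ : Vector Carrier 0) a c b d → (ρ ⊨ₗ (lin a c ≤ₗ lin b d)) ⇔ c ≤ d
    ⊨ₗ-closed⇔ 0≢1 ρ a c b d =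
      mk⇔ (·𝟙-cancel-≤ 0≢1 ∘ +-cancelˡ-≼ 𝟘) (+-monoˡ-≼ 𝟘 ∘ ·𝟙-mono-≤)

  sumFin≡sum : ∀ n (f : Vector Carrier n) → sumFin S n f ≡ sum f
  sumFin≡sum zero f = refl
  sumFin≡sum (suc n) f = cong (head f ⊕_) (sumFin≡sum n (tail f))

  times≡· : ∀ n x → times S n x ≡ n · x
  times≡· zero x = refl
  times≡· (suc zero) x = sym (+-identity x)
  times≡· (suc (suc n)) x = cong (x ⊕_) (times≡· (suc n) x)

  numeral≡·𝟙 : ∀ n → numeral S n ≡ n · 𝟙
  numeral≡·𝟙 zero = refl
  numeral≡·𝟙 (suc n) = cong (𝟙 ⊕_) (numeral≡·𝟙 n)

  numeral⊗≡· : ∀ n x → numeral S n ⊗ x ≡ n · x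
  numeral⊗≡· n x = trans (cong (_⊗ x) (numeral≡·𝟙 n)) (sym (·≡·𝟙⊗ n x))

  module _ {n : ℕ} (ρ : Vector Carrier n) (s t : LinTerm n) where

    ⟦clearedLhs⟧ : proj₁ (clearedSides S ρ s t) ≡ ⟦ clearedLhs s t ⟧ ρ
    ⟦clearedLhs⟧ = cong₂ _⊕_
      (trans (sumFin≡sum n _) (sum-cong-≗ λ i → numeral⊗≡· (negPart (clearedCoeff s t i)) (ρ i)))
      (numeral≡·𝟙 (negPart (clearedConst s t)))

    ⟦clearedRhs⟧ : proj₂ (clearedSides S ρ s t) ≡ ⟦ clearedRhs s t ⟧ ρ
    ⟦clearedRhs⟧ = cong₂ _⊕_
      (trans (sumFin≡sum n _) (sum-cong-≗ λ i → numeral⊗≡· (posPart (clearedCoeff s t i)) (ρ i)))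
      (numeral≡·𝟙 (posPart (clearedConst s t)))

  ⊨⇒disjunct : ∀ {n} (ρ : Vector Carrier n) F → _⊨_ S ρ F → ∃ λ d → All (ρ ⊨ₗ_) (ineqs F d)
  ⊨⇒disjunct ρ (s ≤ₐ t) h = tt , subst₂ _≼_ (⟦clearedLhs⟧ ρ s t) (⟦clearedRhs⟧ ρ s t) h ∷ []
  ⊨⇒disjunct ρ (s =ₐ t) h = tt , ≼-reflexive lhs≡rhs ∷ ≼-reflexive (sym lhs≡rhs) ∷ []
    where
    lhs≡rhs : ⟦ clearedLhs s t ⟧ ρ ≡ ⟦ clearedRhs s t ⟧ ρ
    lhs≡rhs = trans (sym (⟦clearedLhs⟧ ρ s t)) (trans h (⟦clearedRhs⟧ ρ s t))
    ≼-reflexive : ∀ {x y} → x ≡ y → x ≼ y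
    ≼-reflexive refl = ≼-refl _
  ⊨⇒disjunct ρ (F ∧ G) (hF , hG) =
    let (d , hd) = ⊨⇒disjunct ρ F hF
        (e , he) = ⊨⇒disjunct ρ G hG
    in (d , e) , ++⁺ hd he
  ⊨⇒disjunct ρ (F ∨ G) (inj₁ hF) = let (d , hd) = ⊨⇒disjunct ρ F hF in inj₁ d , hd
  ⊨⇒disjunct ρ (F ∨ G) (inj₂ hG) = let (e , he) = ⊨⇒disjunct ρ G hG in inj₂ e , he

  disjunct⇒⊨ : ∀ {n} (ρ : Vector Carrier n) F d → All (ρ ⊨ₗ_) (ineqs F d) → _⊨_ S ρ F
  disjunct⇒⊨ ρ (s ≤ₐ t) _ (h ∷ []) =
    subst₂ _≼_ (sym (⟦clearedLhs⟧ ρ s t)) (sym (⟦clearedRhs⟧ ρ s t)) h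
  disjunct⇒⊨ ρ (s =ₐ t) _ (h ∷ h′ ∷ []) =
    trans (⟦clearedLhs⟧ ρ s t) (trans (≼-antisym _ _ h h′) (sym (⟦clearedRhs⟧ ρ s t)))
  disjunct⇒⊨ ρ (F ∧ G) (d , e) h =
    let (hd , he) = ++⁻ (ineqs F d) h in disjunct⇒⊨ ρ F d hd , disjunct⇒⊨ ρ G e he
  disjunct⇒⊨ ρ (F ∨ G) (inj₁ d) h = inj₁ (disjunct⇒⊨ ρ F d h)
  disjunct⇒⊨ ρ (F ∨ G) (inj₂ e) h = inj₂ (disjunct⇒⊨ ρ G e h)

-- The reals

module Reals {ℝ : Structure} (isℝ : IsReals ℝ) where
  open Structure ℝ
  open IsReals isℝ using (≼-refl; ≼-trans; ≼-antisym; ≼-total; +-mono; *-inverse; *-mono; 0≢1)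

  isAdditivelyOrderedRing : IsAdditivelyOrderedRing ℝ
  isAdditivelyOrderedRing = record { IsReals isℝ }

  open AdditivelyOrderedRing isAdditivelyOrderedRing
  open CommutativeRing commutativeRing using (ring; *-commutativeSemigroup; -‿inverseʳ; -‿inverseˡ; +-identityˡ)
  open import Algebra.Properties.Ring ring using (-1*x≈-x; -‿involutive)
  module ⊗ = Algebra.Properties.CommutativeSemigroup *-commutativeSemigroup

  -- If 𝟙 ≼ 𝟘 then 𝟘 ≼ -𝟙, so 𝟘 ≼ (-𝟙)(-𝟙) = 𝟙 contradicts 𝟘 ≢ 𝟙.
  0≼1 : 𝟘 ≼ 𝟙
  0≼1 with ≼-total 𝟘 𝟙
  ... | inj₁ 0≼1 = 0≼1
  ... | inj₂ 1≼0 = ⊥-elim (0≢1 (≼-antisym _ _ 0≼[-1][-1] 1≼0))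
    where
    0≼-1 : 𝟘 ≼ neg 𝟙
    0≼-1 = subst₂ _≼_ (-‿inverseʳ 𝟙) (+-identityˡ (neg 𝟙)) (+-mono _ _ (neg 𝟙) 1≼0)
    0≼[-1][-1] : 𝟘 ≼ 𝟙
    0≼[-1][-1] = subst (𝟘 ≼_) (trans (-1*x≈-x (neg 𝟙)) (-‿involutive 𝟙)) (*-mono _ _ 0≼-1 0≼-1)

  suc·𝟙≢𝟘 : ∀ k → suc k · 𝟙 ≢ 𝟘
  suc·𝟙≢𝟘 k eq with ·𝟙-cancel-≤ 0≼1 0≢1 {suc k} {0} (subst (suc k · 𝟙 ≼_) eq (≼-refl _))
  ... | ()

  infixl 7 _/suc_
  _/suc_ : Carrier → ℕ → Carrier
  y /suc k = y ⊗ proj₁ (*-inverse (suc k · 𝟙) (suc·𝟙≢𝟘 k))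

  ·-/suc : ∀ k y → suc k · (y /suc k) ≡ y
  ·-/suc k y = begin
    suc k · (y ⊗ inv)      ≡⟨ ·≡·𝟙⊗ (suc k) _ ⟩
    suc k · 𝟙 ⊗ (y ⊗ inv)  ≡⟨ ⊗.x∙yz≈y∙xz _ _ _ ⟩
    y ⊗ (suc k · 𝟙 ⊗ inv)  ≡⟨ cong (y ⊗_) (proj₂ (*-inverse (suc k · 𝟙) (suc·𝟙≢𝟘 k))) ⟩
    y ⊗ 𝟙                  ≡⟨ *-identity y ⟩
    y                      ∎
    where
    open ≡-Reasoning
    open IsReals isℝ using (*-identity)
    inv = proj₁ (*-inverse (suc k · 𝟙) (suc·𝟙≢𝟘 k))

  /suc-· : ∀ k y → (suc k · y) /suc k ≡ y
  /suc-· k y = begin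
    suc k · y ⊗ inv        ≡⟨ cong (_⊗ inv) (·≡·𝟙⊗ (suc k) y) ⟩
    suc k · 𝟙 ⊗ y ⊗ inv    ≡⟨ ⊗.xy∙z≈y∙xz _ _ _ ⟩
    y ⊗ (suc k · 𝟙 ⊗ inv)  ≡⟨ cong (y ⊗_) (proj₂ (*-inverse (suc k · 𝟙) (suc·𝟙≢𝟘 k))) ⟩
    y ⊗ 𝟙                  ≡⟨ *-identity y ⟩
    y                      ∎
    where
    open ≡-Reasoning
    open IsReals isℝ using (*-identity)
    inv = proj₁ (*-inverse (suc k · 𝟙) (suc·𝟙≢𝟘 k))

  ·-injective : ∀ k {a b} → suc k · a ≡ suc k · b → a ≡ b
  ·-injective k {a} {b} eq = trans (sym (/suc-· k a)) (trans (cong (_/suc k) eq) (/suc-· k b))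

  ·-cancel-≼ : ∀ k {a b} → suc k · a ≼ suc k · b → a ≼ b
  ·-cancel-≼ k {a} {b} h with ≼-total a b
  ... | inj₁ a≼b = a≼b
  ... | inj₂ b≼a = subst (a ≼_) (·-injective k (≼-antisym _ _ h (·-mono-≼ (suc k) b≼a))) (≼-refl a)

  isLRR : IsLRR ℝ
  isLRR = record
    { IsReals isℝ
    ; 0≼1 = 0≼1
    ; divisible = λ { (suc k) _ → 𝟙 /suc k , trans (times≡· (suc k) _) (·-/suc k 𝟙) }
    ; torsion-free = λ { (suc k) _ x h →
        ·-cancel-≼ k (subst₂ _≼_ (sym (·-zeroʳ (suc k))) (times≡· (suc k) x) h) }
    }

  lowerValue upperValue : ∀ {m} → Vector Carrier m → Bound m → Carrier
  lowerValue ρ (bound k A B) = (⟦ A ⟧ ρ ⊕ neg (⟦ B ⟧ ρ)) /suc k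
  upperValue ρ (bound k A B) = (⟦ B ⟧ ρ ⊕ neg (⟦ A ⟧ ρ)) /suc k

  ·-/suc-difference : ∀ k y z → suc k · ((y ⊕ neg z) /suc k) ⊕ z ≡ y
  ·-/suc-difference k y z = begin
    suc k · ((y ⊕ neg z) /suc k) ⊕ z ≡⟨ cong (_⊕ z) (·-/suc k _) ⟩
    y ⊕ neg z ⊕ z                    ≡⟨ +-assoc y (neg z) z ⟩
    y ⊕ (neg z ⊕ z)                  ≡⟨ cong (y ⊕_) (-‿inverseˡ z) ⟩
    y ⊕ 𝟘                            ≡⟨ +-identity y ⟩
    y                                ∎
    where
    open ≡-Reasoning
    open IsReals isℝ using (+-assoc; +-identity)

  module _ {m : ℕ} (ρ : Vector Carrier m) (x : Carrier) where

    lowerValue≼⇒LowerBoundHolds : ∀ l → lowerValue ρ l ≼ x → LowerBoundHolds ρ x l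
    lowerValue≼⇒LowerBoundHolds (bound k A B) h =
      subst (_≼ suc k · x ⊕ ⟦ B ⟧ ρ) (·-/suc-difference k _ _) (+-mono _ _ _ (·-mono-≼ (suc k) h))

    ≼upperValue⇒UpperBoundHolds : ∀ u → x ≼ upperValue ρ u → UpperBoundHolds ρ x u
    ≼upperValue⇒UpperBoundHolds (bound k A B) h =
      subst (suc k · x ⊕ ⟦ A ⟧ ρ ≼_) (·-/suc-difference k _ _) (+-mono _ _ _ (·-mono-≼ (suc k) h))

  combine⇒lowerValue≼upperValue : ∀ {m} (ρ : Vector Carrier m) l u →
    ρ ⊨ₗ combine l u → lowerValue ρ l ≼ upperValue ρ u
  combine⇒lowerValue≼upperValue ρ (bound k A₁ B₁) (bound j A₂ B₂) h =
    ·-cancel-≼ k (·-cancel-≼ j (+-cancelʳ-≼ (q · b₁ ⊕ p · a₂) (begin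
      q · (p · ℓ) ⊕ (q · b₁ ⊕ p · a₂) ≡⟨ +-assoc _ _ _ ⟨
      q · (p · ℓ) ⊕ q · b₁ ⊕ p · a₂   ≡⟨ cong (_⊕ p · a₂) (×-distrib-+ _ _ q) ⟨
      q · (p · ℓ ⊕ b₁) ⊕ p · a₂       ≡⟨ cong (λ t → q · t ⊕ p · a₂) (·-/suc-difference k a₁ b₁) ⟩
      q · a₁ ⊕ p · a₂                 ≡⟨ ⟦·ₗ+ₗ·ₗ⟧ q p A₁ A₂ ρ ⟨
      ⟦ q ·ₗ A₁ +ₗ p ·ₗ A₂ ⟧ ρ        ≤⟨ h ⟩
      ⟦ q ·ₗ B₁ +ₗ p ·ₗ B₂ ⟧ ρ        ≡⟨ ⟦·ₗ+ₗ·ₗ⟧ q p B₁ B₂ ρ ⟩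
      q · b₁ ⊕ p · b₂                 ≡⟨ cong (λ t → q · b₁ ⊕ p · t) (·-/suc-difference j b₂ a₂) ⟨
      q · b₁ ⊕ p · (q · υ ⊕ a₂)       ≡⟨ cong (q · b₁ ⊕_) (×-distrib-+ _ _ p) ⟩
      q · b₁ ⊕ (p · (q · υ) ⊕ p · a₂) ≡⟨ x∙yz≈y∙xz _ _ _ ⟩
      p · (q · υ) ⊕ (q · b₁ ⊕ p · a₂) ≡⟨ cong (_⊕ (q · b₁ ⊕ p · a₂)) (·-comm p q υ) ⟩
      q · (p · υ) ⊕ (q · b₁ ⊕ p · a₂) ∎)))
    where
    open ≼-Reasoning
    open IsReals isℝ using (+-assoc)
    p q : ℕ
    p = suc k
    q = suc j
    a₁ a₂ b₁ b₂ ℓ υ : Carrier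
    a₁ = ⟦ A₁ ⟧ ρ
    a₂ = ⟦ A₂ ⟧ ρ
    b₁ = ⟦ B₁ ⟧ ρ
    b₂ = ⟦ B₂ ⟧ ρ
    ℓ = lowerValue ρ (bound k A₁ B₁)
    υ = upperValue ρ (bound j A₂ B₂)

  ∃-lowerBound : ∀ {B : Set} (hi : B → Carrier) us → ∃ λ x → All (λ u → x ≼ hi u) us
  ∃-lowerBound hi [] = 𝟘 , []
  ∃-lowerBound hi (u ∷ us) with ∃-lowerBound hi us
  ... | x , x≼us with ≼-total x (hi u)
  ...   | inj₁ x≼u = x , x≼u ∷ x≼us
  ...   | inj₂ u≼x = hi u , ≼-refl _ ∷ All.map (≼-trans _ _ _ u≼x) x≼us

  ∃-between : ∀ {A B : Set} (lo : A → Carrier) (hi : B → Carrier) ls us →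
    (∀ {l u} → l ∈ ls → u ∈ us → lo l ≼ hi u) →
    ∃ λ x → All (λ l → lo l ≼ x) ls × All (λ u → x ≼ hi u) us
  ∃-between lo hi [] us _ = let (x , x≼us) = ∃-lowerBound hi us in x , [] , x≼us
  ∃-between lo hi (l ∷ ls) us lo≼hi with ∃-between lo hi ls us (lo≼hi ∘ there)
  ... | x , ls≼x , x≼us with ≼-total (lo l) x
  ...   | inj₁ l≼x = x , l≼x ∷ ls≼x , x≼us
  ...   | inj₂ x≼l = lo l , ≼-refl _ ∷ All.map (λ h → ≼-trans _ _ _ h x≼l) ls≼x , All.tabulate (lo≼hi (here refl))

  eliminate-complete : ∀ {m} (ρ : Vector Carrier m) cs →
    All (ρ ⊨ₗ_) (eliminate cs) → ∃ λ x → All ((x ∷ᵛ ρ) ⊨ₗ_) cs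
  eliminate-complete ρ cs h =
    let (hf , hc) = ++⁻ (frees s) h
        (x , ls≼x , x≼us) = ∃-between (lowerValue ρ) (upperValue ρ) (lowers s) (uppers s)
          λ {l} {u} l∈ u∈ → combine⇒lowerValue≼upperValue ρ l u
                              (All.lookup hc (∈-cartesianProductWith⁺ combine l∈ u∈))
    in x , from (splitOnHead-correct (x ∷ᵛ ρ) cs)
                (hf , All.map (λ {l} → lowerValue≼⇒LowerBoundHolds ρ x l) ls≼x
                    , All.map (λ {u} → ≼upperValue⇒UpperBoundHolds ρ x u) x≼us)
    where s = splitOnHead cs

-- From models of LRR to the reals

isLRR⇒isAdditivelyOrderedRing : ∀ {S} → IsLRR S → IsAdditivelyOrderedRing S
isLRR⇒isAdditivelyOrderedRing isS = record { IsLRR isS }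

module _ {S : Structure} (isS : IsLRR S) {ℝ : Structure} (isℝ : IsReals ℝ) where
  private
    module Model = AdditivelyOrderedRing (isLRR⇒isAdditivelyOrderedRing isS)
    module Real = AdditivelyOrderedRing (Reals.isAdditivelyOrderedRing isℝ)

  solution-transfer : ∀ {n} (cs : List (Ineq n)) →
    (∃ λ ρ → All (ρ Model.⊨ₗ_) cs) → ∃ λ ρ′ → All (ρ′ Real.⊨ₗ_) cs
  solution-transfer {zero} cs (ρ , h) = []ᵛ , All.map (λ {c} → closed c) h
    where
    closed : ∀ c → ρ Model.⊨ₗ c → []ᵛ Real.⊨ₗ c
    closed (lin a c ≤ₗ lin b d) =
      from (Real.⊨ₗ-closed⇔ (Reals.0≼1 isℝ) (IsReals.0≢1 isℝ) []ᵛ a c b d)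
      ∘ to (Model.⊨ₗ-closed⇔ (IsLRR.0≼1 isS) (IsLRR.0≢1 isS) ρ a c b d)
  solution-transfer {suc n} cs (ρ , h) =
    let (ρ′ , h′) = solution-transfer (eliminate cs) (tail ρ , Model.eliminate-sound ρ cs h)
        (x , hx) = Reals.eliminate-complete isℝ ρ′ cs h′
    in x ∷ᵛ ρ′ , hx

theorem3p1 : (ℝ : Structure) → (isℝ : IsReals ℝ) → (n : ℕ) → (F : Formula n) →
    (SatLRA ℝ isℝ F → SatLRR F) × (SatLRR F → SatLRA ℝ isℝ F)
theorem3p1 ℝ isℝ n F = (λ (ρ , ρ⊨F) → ℝ , Reals.isLRR isℝ , ρ , ρ⊨F) , fromLRR
  where
  fromLRR : SatLRR F → SatLRA ℝ isℝ F
  fromLRR (S , isS , ρ , ρ⊨F) =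
    let (d , ρ⊨d) = AdditivelyOrderedRing.⊨⇒disjunct (isLRR⇒isAdditivelyOrderedRing isS) ρ F ρ⊨F
        (ρ′ , ρ′⊨d) = solution-transfer isS isℝ (ineqs F d) (ρ , ρ⊨d)
    in ρ′ , AdditivelyOrderedRing.disjunct⇒⊨ (Reals.isAdditivelyOrderedRing isℝ) ρ′ F d ρ′⊨d
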